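{- Let $p$ be an odd prime, let $1\leq r\leq p-2$ be an integer, let $j=\left\lfloor\frac{p}{p-r}\right\rfloor$ and $\alpha=\frac{p}{(p-r)(j+1)}$. Then there is a real number $\varepsilon(p,r)$ with $0<\varepsilon(p,r)<1$ such that \[\alpha<\frac{p+\varepsilon(p,r)}{(p-r)(j+1)}<\frac{\frac{r}{p-r}}{j-1+\frac{r}{p}}.\] -}

module Defs where

open import Data.Nat using (ℕ)
open import Data.Integer using (ℤ; +_)
open import Data.Rational using (ℚ; _/_; _÷_; _+_; _-_; _*_; 0ℚ; 1ℚ; floor; ≢-nonZero)
open import Data.Rational.Properties using (_≟_)
open import Relation.Nullary using (yes; no)

ℕ→ℚ : ℕ → ℚ
ℕ→ℚ n = (+ n) / 1

ℤ→ℚ : ℤ → ℚ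
ℤ→ℚ z = z / 1

-- total division on ℚ (x ÷? 0 = 0); only ever applied to nonzero
-- denominators in the statement below, so the convention is irrelevant.
_÷?_ : ℚ → ℚ → ℚ
x ÷? y with y ≟ 0ℚ
... | yes _  = 0ℚ
... | no y≢0 = _÷_ x y {{≢-nonZero y≢0}}

jOf : ℕ → ℕ → ℤ
jOf p r = floor (ℕ→ℚ p ÷? (ℕ→ℚ p - ℕ→ℚ r))

denomOf : ℕ → ℕ → ℚ
denomOf p r = (ℕ→ℚ p - ℕ→ℚ r) * (ℤ→ℚ (jOf p r) + 1ℚ)

alphaOf : ℕ → ℕ → ℚ
alphaOf p r = ℕ→ℚ p ÷? denomOf p r

midOf : ℕ → ℕ → ℚ → ℚ
midOf p r ε = (ℕ→ℚ p + ε) ÷? denomOf p r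

rhsOf : ℕ → ℕ → ℚ
rhsOf p r = (ℕ→ℚ r ÷? (ℕ→ℚ p - ℕ→ℚ r))
            ÷? ((ℤ→ℚ (jOf p r) - 1ℚ) + (ℕ→ℚ r ÷? ℕ→ℚ p))

-- Put d = p − r, so 1 < d < p, and divide r = c d + s; then s ≠ 0 because d does not
-- divide p, and j = c + 1.  With M = (j − 1) p + r one has r (j + 1) = M + s, so the
-- right-hand side equals (p + p s / M) / ((p − r)(j + 1)) and any 0 < ε < p s / M works,
-- e.g. ε = 1 / (M + 1).  Every quantity involved is a fraction of natural numbers, so each
-- identity and inequality reduces to one between natural numbers by cross-multiplication.

module Submission where

open import Defs
open import Data.Nat using (ℕ; _≤_; _∸_)
open import Data.Nat.Divisibility using (_∣_)
open import Data.Nat.Primality using (Prime; prime⇒nonTrivial)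
open import Data.Rational using (ℚ; _<_; 0ℚ; 1ℚ)
open import Data.Product using (∃-syntax; _×_)
open import Relation.Nullary using (¬_)

open import Data.Integer.Base as ℤ using (+_)
import Data.Integer.Properties as ℤ
open import Data.Nat.Base as ℕ using (suc; pred; _+_; _*_; NonZero)
import Data.Nat.Properties as ℕ
open import Data.Nat.DivMod as ℕ using (_/_; _%_)
open import Data.Nat.Coprimality using (Coprime; prime⇒coprime)
open import Data.Nat.Divisibility using (∣-refl; ∣m∣n⇒∣m+n; m%n≡0⇒n∣m)
open import Data.Nat.Tactic.RingSolver using (solve-∀)
import Data.Rational as ℚ
open import Data.Rational.Properties as ℚ using (toℚᵘ-injective; toℚᵘ-cancel-<)
open import Data.Rational.Unnormalised as ℚᵘ using (mkℚᵘ; *≡*; *<*) renaming (_≃_ to _≃ᵘ_)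
import Data.Rational.Unnormalised.Properties as ℚᵘ
open import Data.Product using (_,_)
open import Relation.Binary.PropositionalEquality
open import Relation.Nullary using (yes; no; contradiction)
open import Algebra.Properties.AbelianGroup ℚ.+-0-abelianGroup using (xyx⁻¹≈y)

private
  toℚᵘ-/ : ∀ a b .{{_ : NonZero b}} → ℚ.toℚᵘ (+ a ℚ./ b) ≃ᵘ mkℚᵘ (+ a) (pred b)
  toℚᵘ-/ a (suc b) = ℚ.toℚᵘ-fromℚᵘ (mkℚᵘ (+ a) b)

  mkℚᵘ-cross : ∀ a b c e .{{_ : NonZero b}} .{{_ : NonZero e}} →
               a * e ≡ c * b → mkℚᵘ (+ a) (pred b) ≃ᵘ mkℚᵘ (+ c) (pred e)
  mkℚᵘ-cross a (suc _) c (suc _) eq = *≡* (trans (sym (ℤ.pos-* a _)) (trans (cong +_ eq) (ℤ.pos-* c _)))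

/-<-cross : ∀ a b c e .{{_ : NonZero b}} .{{_ : NonZero e}} →
            a * e ℕ.< c * b → + a ℚ./ b < + c ℚ./ e
/-<-cross a b@(suc _) c e@(suc _) lt = toℚᵘ-cancel-< (begin-strict
  ℚ.toℚᵘ (+ a ℚ./ b)  ≃⟨ toℚᵘ-/ a b ⟩
  mkℚᵘ (+ a) (pred b) <⟨ *<* (subst₂ ℤ._<_ (ℤ.pos-* a e) (ℤ.pos-* c b) (ℤ.+<+ lt)) ⟩
  mkℚᵘ (+ c) (pred e) ≃⟨ ℚᵘ.≃-sym (toℚᵘ-/ c e) ⟩
  ℚ.toℚᵘ (+ c ℚ./ e)  ∎)
  where open ℚᵘ.≤-Reasoning

+-/-cross : ∀ a b c e g f .{{_ : NonZero b}} .{{_ : NonZero e}} .{{_ : NonZero f}} →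
            (a * e + c * b) * f ≡ g * (b * e) → + a ℚ./ b ℚ.+ + c ℚ./ e ≡ + g ℚ./ f
+-/-cross a b@(suc _) c e@(suc _) g f eq = toℚᵘ-injective (begin
  ℚ.toℚᵘ (+ a ℚ./ b ℚ.+ + c ℚ./ e)              ≈⟨ ℚ.toℚᵘ-homo-+ (+ a ℚ./ b) (+ c ℚ./ e) ⟩
  ℚ.toℚᵘ (+ a ℚ./ b) ℚᵘ.+ ℚ.toℚᵘ (+ c ℚ./ e)   ≈⟨ ℚᵘ.+-cong (toℚᵘ-/ a b) (toℚᵘ-/ c e) ⟩
  mkℚᵘ (+ a) (pred b) ℚᵘ.+ mkℚᵘ (+ c) (pred e) ≡⟨ cong (λ n → mkℚᵘ n (pred (b * e))) numerator ⟩
  mkℚᵘ (+ (a * e + c * b)) (pred (b * e))       ≈⟨ mkℚᵘ-cross _ (b * e) g f eq ⟩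
  mkℚᵘ (+ g) (pred f)                           ≈⟨ ℚᵘ.≃-sym (toℚᵘ-/ g f) ⟩
  ℚ.toℚᵘ (+ g ℚ./ f)                            ∎)
  where
  open ℚᵘ.≃-Reasoning
  numerator : + a ℤ.* + e ℤ.+ + c ℤ.* + b ≡ + (a * e + c * b)
  numerator = sym (trans (ℤ.pos-+ (a * e) (c * b)) (cong₂ ℤ._+_ (ℤ.pos-* a e) (ℤ.pos-* c b)))

*-/-cross : ∀ a b c e g f .{{_ : NonZero b}} .{{_ : NonZero e}} .{{_ : NonZero f}} →
            (a * c) * f ≡ g * (b * e) → (+ a ℚ./ b) ℚ.* (+ c ℚ./ e) ≡ + g ℚ./ f
*-/-cross a b@(suc _) c e@(suc _) g f eq = toℚᵘ-injective (begin
  ℚ.toℚᵘ ((+ a ℚ./ b) ℚ.* (+ c ℚ./ e))          ≈⟨ ℚ.toℚᵘ-homo-* (+ a ℚ./ b) (+ c ℚ./ e) ⟩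
  ℚ.toℚᵘ (+ a ℚ./ b) ℚᵘ.* ℚ.toℚᵘ (+ c ℚ./ e)   ≈⟨ ℚᵘ.*-cong (toℚᵘ-/ a b) (toℚᵘ-/ c e) ⟩
  mkℚᵘ (+ a) (pred b) ℚᵘ.* mkℚᵘ (+ c) (pred e) ≡⟨ cong (λ n → mkℚᵘ n (pred (b * e))) numerator ⟩
  mkℚᵘ (+ (a * c)) (pred (b * e))               ≈⟨ mkℚᵘ-cross _ (b * e) g f eq ⟩
  mkℚᵘ (+ g) (pred f)                           ≈⟨ ℚᵘ.≃-sym (toℚᵘ-/ g f) ⟩
  ℚ.toℚᵘ (+ g ℚ./ f)                            ∎)
  where
  open ℚᵘ.≃-Reasoning
  numerator : + a ℤ.* + c ≡ + (a * c)
  numerator = sym (ℤ.pos-* a c)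

*-inverseʳ-unique : ∀ p .{{_ : ℚ.NonZero p}} q → p ℚ.* q ≡ 1ℚ → ℚ.1/ p ≡ q
*-inverseʳ-unique p q pq≡1 = begin
  ℚ.1/ p                  ≡⟨ ℚ.*-identityʳ (ℚ.1/ p) ⟨
  ℚ.1/ p ℚ.* 1ℚ           ≡⟨ cong (ℚ.1/ p ℚ.*_) pq≡1 ⟨
  ℚ.1/ p ℚ.* (p ℚ.* q)    ≡⟨ ℚ.*-assoc (ℚ.1/ p) p q ⟨
  (ℚ.1/ p ℚ.* p) ℚ.* q    ≡⟨ cong (ℚ._* q) (ℚ.*-inverseˡ p) ⟩
  1ℚ ℚ.* q                ≡⟨ ℚ.*-identityˡ q ⟩
  q                       ∎
  where open ≡-Reasoning

÷?-/ : ∀ x a b .{{_ : NonZero a}} .{{_ : NonZero b}} → x ÷? (+ a ℚ./ b) ≡ x ℚ.* (+ b ℚ./ a)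
÷?-/ x a@(suc _) b with + a ℚ./ b ℚ.≟ 0ℚ
... | yes a/b≡0 = contradiction (sym a/b≡0) (ℚ.<⇒≢ (/-<-cross 0 1 a b (ℕ.s≤s ℕ.z≤n)))
... | no a/b≢0  = cong (x ℚ.*_) (*-inverseʳ-unique _ {{ℚ.≢-nonZero a/b≢0}} _
                    (*-/-cross a b b a 1 1 (identity a b)))
  where
  identity : ∀ a b → a * b * 1 ≡ 1 * (b * a)
  identity = solve-∀

ℕ→ℚ-÷? : ∀ a b .{{_ : NonZero b}} → ℕ→ℚ a ÷? ℕ→ℚ b ≡ + a ℚ./ b
ℕ→ℚ-÷? a b = trans (÷?-/ (ℕ→ℚ a) b 1) (*-/-cross a 1 1 b a b (identity a b))
  where
  identity : ∀ a b → a * 1 * b ≡ a * (1 * b)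
  identity = solve-∀

ℕ→ℚ-+-/ : ∀ a b e .{{_ : NonZero e}} → ℕ→ℚ a ℚ.+ + b ℚ./ e ≡ + (a * e + b) ℚ./ e
ℕ→ℚ-+-/ a b e = +-/-cross a 1 b e (a * e + b) e (identity a b e)
  where
  identity : ∀ a b e → (a * e + b * 1) * e ≡ (a * e + b) * (1 * e)
  identity = solve-∀

ℕ→ℚ-m+n-m≡n : ∀ m n → ℕ→ℚ (m + n) ℚ.- ℕ→ℚ m ≡ ℕ→ℚ n
ℕ→ℚ-m+n-m≡n m n = begin
  ℕ→ℚ (m + n) ℚ.- ℕ→ℚ m          ≡⟨ cong (ℚ._- ℕ→ℚ m) (+-/-cross m 1 n 1 (m + n) 1 (identity m n)) ⟨
  ℕ→ℚ m ℚ.+ ℕ→ℚ n ℚ.- ℕ→ℚ m      ≡⟨ xyx⁻¹≈y (ℕ→ℚ m) (ℕ→ℚ n) ⟩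
  ℕ→ℚ n                          ∎
  where
  open ≡-Reasoning
  identity : ∀ m n → (m * 1 + n * 1) * 1 ≡ (m + n) * (1 * 1)
  identity = solve-∀

floor-/ : ∀ a b .{{_ : NonZero b}} → Coprime a b → ℚ.floor (+ a ℚ./ b) ≡ + (a / b)
floor-/ a (suc b) coprime rewrite ℚ.normalize-coprime {a} {b} coprime = ℤ.*-identityˡ _

Admissible : ℕ → ℕ → ℚ → Set
Admissible p r ε = 0ℚ < ε × ε < 1ℚ × alphaOf p r < midOf p r ε × midOf p r ε < rhsOf p r

module Division (r d : ℕ) .{{_ : NonZero d}} (1<d : 1 ℕ.< d) (coprime : Coprime (r + d) d) where

  p c s j M N D : ℕ
  p = r + d
  c = r / d
  s = r % d
  j = suc c
  M = c * p + r
  N = suc M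
  D = d * suc j

  r≡c*d+s : r ≡ c * d + s
  r≡c*d+s = trans (ℕ.m≡m%n+[m/n]*n r d) (ℕ.+-comm s (c * d))

  private instance
    s≢0 : NonZero s
    s≢0 = ℕ.≢-nonZero λ s≡0 →
      ℕ.<⇒≢ 1<d (sym (coprime (∣m∣n⇒∣m+n (m%n≡0⇒n∣m r d s≡0) ∣-refl , ∣-refl)))

    p≢0 : NonZero p
    p≢0 = ℕ.>-nonZero (ℕ.<-≤-trans (ℕ.>-nonZero⁻¹ d) (ℕ.m≤n+m d r))

    M≢0 : NonZero M
    M≢0 = ℕ.>-nonZero (ℕ.<-≤-trans (ℕ.>-nonZero⁻¹ s) (ℕ.≤-trans (ℕ.m%n≤m r d) (ℕ.m≤n+m r (c * p))))

    D≢0 : NonZero D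
    D≢0 = ℕ.m*n≢0 d (suc j)

    d*M≢0 : NonZero (d * M)
    d*M≢0 = ℕ.m*n≢0 d M

    N*D≢0 : NonZero (N * D)
    N*D≢0 = ℕ.m*n≢0 N D

  r*[1+j]≡M+s : r * suc j ≡ M + s
  r*[1+j]≡M+s = begin
    r * suc j                ≡⟨ identity₁ r c ⟩
    c * r + r + r            ≡⟨ cong (λ t → c * r + r + t) r≡c*d+s ⟩
    c * r + r + (c * d + s)  ≡⟨ identity₂ r c d s ⟩
    M + s                    ∎
    where
    open ≡-Reasoning
    identity₁ : ∀ r c → r * suc (suc c) ≡ c * r + r + r
    identity₁ = solve-∀
    identity₂ : ∀ r c d s → c * r + r + (c * d + s) ≡ c * (r + d) + r + s
    identity₂ = solve-∀

  p*[N*D]<[p*N+1]*D : p * (N * D) ℕ.< (p * N + 1) * D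
  p*[N*D]<[p*N+1]*D = begin-strict
    p * (N * D)        <⟨ ℕ.m<m+n (p * (N * D)) (ℕ.>-nonZero⁻¹ D) ⟩
    p * (N * D) + D    ≡⟨ identity p N D ⟩
    (p * N + 1) * D    ∎
    where
    open ℕ.≤-Reasoning
    identity : ∀ p N D → p * (N * D) + D ≡ (p * N + 1) * D
    identity = solve-∀

  [p*N+1]*[d*M]<r*p*[N*D] : (p * N + 1) * (d * M) ℕ.< r * p * (N * D)
  [p*N+1]*[d*M]<r*p*[N*D] = begin-strict
    (p * N + 1) * (d * M)                ≡⟨ identity₁ p N d M ⟩
    d * (p * N * M) + d * M              <⟨ ℕ.+-monoʳ-< _ (ℕ.*-monoʳ-< d M<N*[p*s]) ⟩
    d * (p * N * M) + d * (N * (p * s))  ≡⟨ identity₂ p N d M s ⟩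
    d * N * p * (M + s)                  ≡⟨ cong (d * N * p *_) r*[1+j]≡M+s ⟨
    d * N * p * (r * suc j)              ≡⟨ identity₃ p N d r (suc j) ⟩
    r * p * (N * D)                      ∎
    where
    open ℕ.≤-Reasoning
    M<N*[p*s] : M ℕ.< N * (p * s)
    M<N*[p*s] = ℕ.<-≤-trans (ℕ.n<1+n M) (ℕ.m≤m*n N (p * s) {{ℕ.m*n≢0 p s}})
    identity₁ : ∀ p N d M → (p * N + 1) * (d * M) ≡ d * (p * N * M) + d * M
    identity₁ = solve-∀
    identity₂ : ∀ p N d M s → d * (p * N * M) + d * (N * (p * s)) ≡ d * N * p * (M + s)
    identity₂ = solve-∀
    identity₃ : ∀ p N d r k → d * N * p * (r * k) ≡ r * p * (N * (d * k))
    identity₃ = solve-∀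

  p-r≡d : ℕ→ℚ p ℚ.- ℕ→ℚ r ≡ ℕ→ℚ d
  p-r≡d = ℕ→ℚ-m+n-m≡n r d

  p/d≡j : p / d ≡ j
  p/d≡j = begin
    (r + d) / d    ≡⟨ ℕ.+-distrib-/-∣ʳ r ∣-refl ⟩
    r / d + d / d  ≡⟨ cong (ℕ._+_ c) (ℕ.n/n≡1 d) ⟩
    c + 1          ≡⟨ ℕ.+-comm c 1 ⟩
    suc c          ∎
    where open ≡-Reasoning

  jOf≡j : jOf p r ≡ + j
  jOf≡j = begin
    ℚ.floor (ℕ→ℚ p ÷? (ℕ→ℚ p ℚ.- ℕ→ℚ r)) ≡⟨ cong (λ q → ℚ.floor (ℕ→ℚ p ÷? q)) p-r≡d ⟩
    ℚ.floor (ℕ→ℚ p ÷? ℕ→ℚ d)             ≡⟨ cong ℚ.floor (ℕ→ℚ-÷? p d) ⟩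
    ℚ.floor (+ p ℚ./ d)                   ≡⟨ floor-/ p d coprime ⟩
    + (p / d)                             ≡⟨ cong +_ p/d≡j ⟩
    + j                                   ∎
    where open ≡-Reasoning

  denomOf≡D : denomOf p r ≡ ℕ→ℚ D
  denomOf≡D = begin
    (ℕ→ℚ p ℚ.- ℕ→ℚ r) ℚ.* (ℤ→ℚ (jOf p r) ℚ.+ 1ℚ)
      ≡⟨ cong₂ ℚ._*_ p-r≡d (cong (λ z → ℤ→ℚ z ℚ.+ 1ℚ) jOf≡j) ⟩
    ℕ→ℚ d ℚ.* (ℕ→ℚ j ℚ.+ 1ℚ)
      ≡⟨ cong (ℕ→ℚ d ℚ.*_) (+-/-cross j 1 1 1 (suc j) 1 (identity₁ j)) ⟩
    ℕ→ℚ d ℚ.* ℕ→ℚ (suc j)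
      ≡⟨ *-/-cross d 1 (suc j) 1 D 1 (identity₂ d (suc j)) ⟩
    ℕ→ℚ D ∎
    where
    open ≡-Reasoning
    identity₁ : ∀ j → (j * 1 + 1 * 1) * 1 ≡ suc j * (1 * 1)
    identity₁ = solve-∀
    identity₂ : ∀ d k → d * k * 1 ≡ d * k * (1 * 1)
    identity₂ = solve-∀

  ε : ℚ
  ε = + 1 ℚ./ N

  alphaOf≡ : alphaOf p r ≡ + p ℚ./ D
  alphaOf≡ = trans (cong (ℕ→ℚ p ÷?_) denomOf≡D) (ℕ→ℚ-÷? p D)

  midOf≡ : midOf p r ε ≡ + (p * N + 1) ℚ./ (N * D)
  midOf≡ = begin
    (ℕ→ℚ p ℚ.+ ε) ÷? denomOf p r            ≡⟨ cong₂ _÷?_ (ℕ→ℚ-+-/ p 1 N) denomOf≡D ⟩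
    (+ (p * N + 1) ℚ./ N) ÷? ℕ→ℚ D          ≡⟨ ÷?-/ _ D 1 ⟩
    (+ (p * N + 1) ℚ./ N) ℚ.* (+ 1 ℚ./ D)   ≡⟨ *-/-cross n N 1 D n (N * D) (identity n (N * D)) ⟩
    + (p * N + 1) ℚ./ (N * D)               ∎
    where
    open ≡-Reasoning
    n : ℕ
    n = p * N + 1
    identity : ∀ a b → a * 1 * b ≡ a * b
    identity = solve-∀

  rhsOf≡ : rhsOf p r ≡ + (r * p) ℚ./ (d * M)
  rhsOf≡ = begin
    (ℕ→ℚ r ÷? (ℕ→ℚ p ℚ.- ℕ→ℚ r)) ÷? ((ℤ→ℚ (jOf p r) ℚ.- 1ℚ) ℚ.+ (ℕ→ℚ r ÷? ℕ→ℚ p))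
      ≡⟨ cong₂ _÷?_ r/[p-r]≡r/d (cong₂ ℚ._+_ j-1≡c (ℕ→ℚ-÷? r p)) ⟩
    (+ r ℚ./ d) ÷? (ℕ→ℚ c ℚ.+ + r ℚ./ p)   ≡⟨ cong ((+ r ℚ./ d) ÷?_) (ℕ→ℚ-+-/ c r p) ⟩
    (+ r ℚ./ d) ÷? (+ M ℚ./ p)             ≡⟨ ÷?-/ _ M p ⟩
    (+ r ℚ./ d) ℚ.* (+ p ℚ./ M)            ≡⟨ *-/-cross r d p M (r * p) (d * M) refl ⟩
    + (r * p) ℚ./ (d * M)                  ∎
    where
    open ≡-Reasoning
    r/[p-r]≡r/d : ℕ→ℚ r ÷? (ℕ→ℚ p ℚ.- ℕ→ℚ r) ≡ + r ℚ./ d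
    r/[p-r]≡r/d = trans (cong (ℕ→ℚ r ÷?_) p-r≡d) (ℕ→ℚ-÷? r d)
    j-1≡c : ℤ→ℚ (jOf p r) ℚ.- 1ℚ ≡ ℕ→ℚ c
    j-1≡c = trans (cong (λ z → ℤ→ℚ z ℚ.- 1ℚ) jOf≡j) (ℕ→ℚ-m+n-m≡n 1 c)

  ε-admissible : Admissible p r ε
  ε-admissible =
    /-<-cross 0 1 1 N (ℕ.s≤s ℕ.z≤n) ,
    /-<-cross 1 N 1 1 (subst (1 ℕ.<_) (sym (ℕ.*-identityˡ N)) (ℕ.s≤s (ℕ.>-nonZero⁻¹ M))) ,
    subst₂ _<_ (sym alphaOf≡) (sym midOf≡)
      (/-<-cross p D (p * N + 1) (N * D) p*[N*D]<[p*N+1]*D) ,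
    subst₂ _<_ (sym midOf≡) (sym rhsOf≡)
      (/-<-cross (p * N + 1) (N * D) (r * p) (d * M) [p*N+1]*[d*M]<r*p*[N*D])

mainTheorem3 : (p r : ℕ) → Prime p → ¬ (2 ∣ p) → 1 ≤ r → r ≤ p ∸ 2 →
    ∃[ ε ] (0ℚ < ε × ε < 1ℚ × alphaOf p r < midOf p r ε × midOf p r ε < rhsOf p r)
mainTheorem3 p r p-prime _ 1≤r r≤p∸2 =
  subst (λ q → ∃[ ε ] Admissible q r ε) r+d≡p
    (Division.ε r d 1<d coprime , Division.ε-admissible r d 1<d coprime)
  where
  d : ℕ
  d = p ∸ r
  r+2≤p : r + 2 ≤ p
  r+2≤p = ℕ.m≤o∸n⇒m+n≤o r (ℕ.nonTrivial⇒n>1 p {{prime⇒nonTrivial p-prime}}) r≤p∸2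
  r≤p : r ≤ p
  r≤p = ℕ.≤-trans (ℕ.m≤m+n r 2) r+2≤p
  r+d≡p : r + d ≡ p
  r+d≡p = ℕ.m+[n∸m]≡n r≤p
  1<d : 1 ℕ.< d
  1<d = ℕ.m+n≤o⇒m≤o∸n 2 (subst (_≤ p) (ℕ.+-comm r 2) r+2≤p)
  instance
    d≢0 : NonZero d
    d≢0 = ℕ.>-nonZero (ℕ.<-trans ℕ.z<s 1<d)
  coprime : Coprime (r + d) d
  coprime = subst (λ q → Coprime q d) (sym r+d≡p) (prime⇒coprime p-prime (ℕ.∸-monoʳ-< 1≤r r≤p))
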